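{- For all integers $a\ge 2$ and $b\ge 1$, we have $\mathrm{irr}(S_{a,b})=a(a-1)$ and $\mathrm{Mo}(S_{a,b})=a^2b^2-ab^2$.
   Context: $S_{a,b}$ denotes the balanced spider of order $ab+1$: a central vertex $c$ together with $a$ vertex-disjoint paths (legs) on $b$ vertices each, each leg joined to $c$ by an edge from one of its endpoints. For a graph $G$, $\mathrm{irr}(G)=\sum_{\{u,v\}\in E(G)}|d_u-d_v|$ where $d_v$ is the degree of $v$. Let $n_G(u,v)$ be the number of vertices strictly closer to $u$ than to $v$; the Mostar index is $\mathrm{Mo}(G)=\sum_{\{u,v\}\in E(G)}|n_G(u,v)-n_G(v,u)|$. -}

module Defs where

open import Data.Bool using (Bool; true; false; _∧_; _∨_; not; if_then_else_)
open import Data.Nat using (ℕ; zero; suc; _+_; _*_; _∸_; _<ᵇ_; _≡ᵇ_; ∣_-_∣)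
open import Data.Nat.Divisibility using (_∣?_)
open import Data.Fin using (Fin; toℕ; fromℕ<)
open import Data.Product using (_×_; _,_)
open import Data.List using (List; []; _∷_; map; allFin; concatMap)
open import Data.Bool.ListAction using (any)
open import Data.Nat.ListAction using (sum)
open import Data.Bool.Properties using (∨-comm)
open import Relation.Nullary.Decidable using (⌊_⌋)
open import Relation.Binary.PropositionalEquality using (_≡_; refl)

record Graph : Set where
  field
    n      : ℕ
    adj    : Fin n → Fin n → Bool
    irrefl : ∀ v → adj v v ≡ false
    sym    : ∀ u v → adj u v ≡ adj v u

module _ (G : Graph) where
  open Graph G

  vertices : List (Fin n)
  vertices = allFin n

  count : (Fin n → Bool) → ℕ
  count P = sum (map (λ v → if P v then 1 else 0) vertices)

  degree : Fin n → ℕ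
  degree v = count (adj v)

  edges : List (Fin n × Fin n)
  edges = concatMap (λ u → concatMap (λ v →
            if (toℕ u <ᵇ toℕ v) ∧ adj u v then (u , v) ∷ [] else []) vertices) vertices

  within : ℕ → Fin n → Fin n → Bool
  within zero    u v = toℕ u ≡ᵇ toℕ v
  within (suc k) u v = within k u v ∨ any (λ w → adj u w ∧ within k w v) vertices

  -- shortest-path distance: least k ≤ n with a walk of length ≤ k
  -- (for disconnected pairs this returns n; irrelevant for connected graphs)
  distGo : ℕ → ℕ → Fin n → Fin n → ℕ
  distGo k zero    u v = k
  distGo k (suc f) u v = if within k u v then k else distGo (suc k) f u v

  dist : Fin n → Fin n → ℕ
  dist u v = distGo 0 n u v

  nCloser : Fin n → Fin n → ℕ
  nCloser u v = count (λ w → dist w u <ᵇ dist w v)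

  irr : ℕ
  irr = sum (map (λ { (u , v) → ∣ degree u - degree v ∣ }) edges)

  mostar : ℕ
  mostar = sum (map (λ { (u , v) → ∣ nCloser u v - nCloser v u ∣ }) edges)

-- Vertex 0 is the centre; leg i (0 ≤ i < a) consists of the vertices
-- 1+i*b, 2+i*b, …, b+i*b, forming a path in that order, and the endpoint
-- 1+i*b is joined to the centre.
-- For x < y (as naturals):  x ~ y  iff
--   (x = 0 and b ∣ y-1)                      -- centre to first vertex of a leg
--   or (x ≥ 1, y = x+1 and ¬ b ∣ x)          -- consecutive vertices of one leg

spiderAdjℕ : ℕ → ℕ → ℕ → Bool
spiderAdjℕ b zero    y = not (y ≡ᵇ 0) ∧ ⌊ b ∣? (y ∸ 1) ⌋
spiderAdjℕ b (suc x) y = (y ≡ᵇ suc (suc x)) ∧ not ⌊ b ∣? suc x ⌋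

-- spiderAdjℕ b x y = true forces x < y, so symmetrising by ∨ is faithful.
spiderAdjSymℕ : ℕ → ℕ → ℕ → Bool
spiderAdjSymℕ b x y = spiderAdjℕ b x y ∨ spiderAdjℕ b y x

private
  ≡ᵇ-suc : ∀ x → (x ≡ᵇ suc x) ≡ false
  ≡ᵇ-suc zero    = refl
  ≡ᵇ-suc (suc x) = ≡ᵇ-suc x

  spiderAdj-irr : ∀ b x → spiderAdjℕ b x x ≡ false
  spiderAdj-irr b zero    = refl
  spiderAdj-irr b (suc x) rewrite ≡ᵇ-suc x = refl

  spiderSym-irr : ∀ b x → spiderAdjSymℕ b x x ≡ false
  spiderSym-irr b x rewrite spiderAdj-irr b x = refl

spider : ℕ → ℕ → Graph
spider a b = record
  { n      = suc (a * b)
  ; adj    = λ u v → spiderAdjSymℕ b (toℕ u) (toℕ v)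
  ; irrefl = λ v → spiderSym-irr b (toℕ v)
  ; sym    = λ u v → ∨-comm (spiderAdjℕ b (toℕ u) (toℕ v)) (spiderAdjℕ b (toℕ v) (toℕ u))
  }

module Submission where

-- The spider is a tree: writing its vertices as (leg i, depth e), the distance from (i, e) to
-- (i′, t) is |e - t| on a common leg and e + t otherwise, and every edge joins the depths t and
-- t + 1 of one leg. Degrees are a at the centre, 2 inside the legs and 1 at the leaves, so every
-- leg contributes a - 1 to irr. For the edge at depth t of a leg, 1 + t + (a - 1) b vertices are
-- closer to its inner end and b - t to its outer end; the differences 2 t + 1 + (a - 2) b summed
-- over t < b give (a - 1) b² per leg.

open import Defs
open import Data.Bool using (Bool; true; false; T; _∧_; _∨_; not; if_then_else_)
open import Data.Bool.Properties
  using (T-≡; T-not-≡; T-∧; T-∨; if-float; if-eta; if-∧; if-cong; if-cong-then; if-cong-else; if-cong₂; ∧-identityʳ; ∧-zeroʳ)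
open import Data.Fin using (Fin; toℕ; fromℕ<)
open import Data.Fin.Properties using (toℕ<n; toℕ-fromℕ<; toℕ-injective)
open import Data.List using (List; []; _∷_; map; allFin; concatMap; tabulate)
open import Data.List.Properties using (map-tabulate; map-++)
open import Data.List.Membership.Propositional.Properties using (∈-allFin)
open import Data.List.Relation.Unary.Any as Any using (satisfied)
open import Data.List.Relation.Unary.Any.Properties using (any⁺; any⁻)
open import Data.Nat
open import Data.Nat.Properties
open import Data.Nat.DivMod
open import Data.Nat.Divisibility using (_∣_; _∣?_; divides; n∣m⇒m%n≡0)
open import Data.Nat.ListAction using (sum)
open import Data.Nat.ListAction.Properties using (sum-++)
open import Data.Nat.Tactic.RingSolver using (solve-∀)
open import Relation.Binary.Definitions using (tri<; tri≈; tri>)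
open import Data.Product using (_×_; _,_; ∃-syntax; proj₁; proj₂)
open import Data.Sum using (inj₁; inj₂)
open import Data.Unit using (tt)
open import Data.Empty using (⊥-elim)
open import Relation.Nullary using (yes; no; ¬_)
open import Relation.Nullary.Decidable using (⌊_⌋; toWitness; fromWitness)
open import Relation.Nullary.Reflects using (fromEquivalence; T-reflects-elim)
open import Function using (_∘_; _$_; Equivalence)
open import Relation.Binary.PropositionalEquality

-- Boolean comparisons and absolute differences

indicator : Bool → ℕ
indicator c = if c then 1 else 0

≡ᵇ-refl : ∀ n → (n ≡ᵇ n) ≡ true
≡ᵇ-refl n = Equivalence.to T-≡ (≡⇒≡ᵇ n n refl)

<⇒<ᵇ≡true : ∀ {m n} → m < n → (m <ᵇ n) ≡ true
<⇒<ᵇ≡true m<n = Equivalence.to T-≡ (<⇒<ᵇ m<n)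

≤⇒>ᵇ≡false : ∀ {m n} → n ≤ m → (m <ᵇ n) ≡ false
≤⇒>ᵇ≡false {m} {n} n≤m = T-reflects-elim (fromEquivalence (λ m<n → <⇒≱ (<ᵇ⇒< m n m<n) n≤m) (λ ()))

≡ᵇ-sym : ∀ m n → (m ≡ᵇ n) ≡ (n ≡ᵇ m)
≡ᵇ-sym m n = T-reflects-elim (fromEquivalence (≡⇒≡ᵇ n m ∘ sym ∘ ≡ᵇ⇒≡ m n) (≡⇒≡ᵇ m n ∘ sym ∘ ≡ᵇ⇒≡ n m))

≢⇒≡ᵇ≡false : ∀ {m n} → m ≢ n → (m ≡ᵇ n) ≡ false
≢⇒≡ᵇ≡false {m} {n} m≢n = T-reflects-elim (fromEquivalence (m≢n ∘ ≡ᵇ⇒≡ m n) (λ ()))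

∣m-n∣≤1+∣1+m-n∣ : ∀ m n → ∣ m - n ∣ ≤ suc ∣ suc m - n ∣
∣m-n∣≤1+∣1+m-n∣ zero    zero    = z≤n
∣m-n∣≤1+∣1+m-n∣ zero    (suc n) = ≤-refl
∣m-n∣≤1+∣1+m-n∣ (suc m) zero    = ≤-trans (n≤1+n _) (n≤1+n _)
∣m-n∣≤1+∣1+m-n∣ (suc m) (suc n) = ∣m-n∣≤1+∣1+m-n∣ m n

∣1+m-n∣≤1+∣m-n∣ : ∀ m n → ∣ suc m - n ∣ ≤ suc ∣ m - n ∣
∣1+m-n∣≤1+∣m-n∣ zero    zero    = s≤s z≤n
∣1+m-n∣≤1+∣m-n∣ zero    (suc n) = ≤-trans (n≤1+n n) (n≤1+n _)
∣1+m-n∣≤1+∣m-n∣ (suc m) zero    = ≤-refl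
∣1+m-n∣≤1+∣m-n∣ (suc m) (suc n) = ∣1+m-n∣≤1+∣m-n∣ m n

∣m-n∣≡1+k⇒∣1+m-n∣≡k : ∀ {m n k} → m < n → ∣ m - n ∣ ≡ suc k → ∣ suc m - n ∣ ≡ k
∣m-n∣≡1+k⇒∣1+m-n∣≡k {zero}  {suc n} _         eq = suc-injective eq
∣m-n∣≡1+k⇒∣1+m-n∣≡k {suc m} {suc n} (s<s m<n) eq = ∣m-n∣≡1+k⇒∣1+m-n∣≡k m<n eq

∣1+m-n∣≡1+k⇒∣m-n∣≡k : ∀ {m n k} → n < suc m → ∣ suc m - n ∣ ≡ suc k → ∣ m - n ∣ ≡ k
∣1+m-n∣≡1+k⇒∣m-n∣≡k {zero}  {zero}  _         eq = suc-injective eq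
∣1+m-n∣≡1+k⇒∣m-n∣≡k {suc m} {zero}  _         eq = suc-injective eq
∣1+m-n∣≡1+k⇒∣m-n∣≡k {suc m} {suc n} (s<s n<m) eq = ∣1+m-n∣≡1+k⇒∣m-n∣≡k n<m eq
∣1+m-n∣≡1+k⇒∣m-n∣≡k {zero}  {suc n} (s<s ())  eq

[m∸n]+[n∸o]≡m∸o : ∀ {m n o} → n ≤ m → o ≤ n → (m ∸ n) + (n ∸ o) ≡ m ∸ o
[m∸n]+[n∸o]≡m∸o {m} {n} {o} n≤m o≤n = trans (sym (+-∸-assoc (m ∸ n) o≤n)) (cong (_∸ o) (m∸n+n≡m n≤m))

indicator≤1 : ∀ p → indicator p ≤ 1
indicator≤1 true  = ≤-refl
indicator≤1 false = z≤n

indicator-∨ : ∀ p q → ¬ (T p × T q) → indicator (p ∨ q) ≡ indicator p + indicator q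
indicator-∨ true  true  ¬p∧q = ⊥-elim (¬p∧q (tt , tt))
indicator-∨ true  false _    = refl
indicator-∨ false q     _    = refl

∣m-n∣<ᵇ∣m-1+n∣ : ∀ m n → (∣ m - n ∣ <ᵇ ∣ m - suc n ∣) ≡ (m <ᵇ suc n)
∣m-n∣<ᵇ∣m-1+n∣ zero          n       = <⇒<ᵇ≡true (n<1+n n)
∣m-n∣<ᵇ∣m-1+n∣ (suc zero)    zero    = refl
∣m-n∣<ᵇ∣m-1+n∣ (suc (suc m)) zero    = ≤⇒>ᵇ≡false (n≤1+n m)
∣m-n∣<ᵇ∣m-1+n∣ (suc m)       (suc n) = ∣m-n∣<ᵇ∣m-1+n∣ m n

∣m-1+n∣<ᵇ∣m-n∣ : ∀ m n → (∣ m - suc n ∣ <ᵇ ∣ m - n ∣) ≡ (n <ᵇ m)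
∣m-1+n∣<ᵇ∣m-n∣ zero          n       = trans (≤⇒>ᵇ≡false (n≤1+n n)) (sym (≤⇒>ᵇ≡false {n} {0} z≤n))
∣m-1+n∣<ᵇ∣m-n∣ (suc zero)    zero    = refl
∣m-1+n∣<ᵇ∣m-n∣ (suc (suc m)) zero    = <⇒<ᵇ≡true (n<1+n m)
∣m-1+n∣<ᵇ∣m-n∣ (suc m)       (suc n) = ∣m-1+n∣<ᵇ∣m-n∣ m n

-- Finite sums

-- Opaque, so that ∑ n f stays rigid in unification and the implicit arguments below get inferred.
opaque
  ∑ : ℕ → (ℕ → ℕ) → ℕ
  ∑ zero    f = 0
  ∑ (suc n) f = f 0 + ∑ n (f ∘ suc)

  ∑-empty : ∀ (f : ℕ → ℕ) → ∑ 0 f ≡ 0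
  ∑-empty f = refl

  ∑-suc : ∀ n (f : ℕ → ℕ) → ∑ (suc n) f ≡ f 0 + ∑ n (f ∘ suc)
  ∑-suc n f = refl

  ∑-cong : ∀ n {f g} → (∀ y → y < n → f y ≡ g y) → ∑ n f ≡ ∑ n g
  ∑-cong zero    f≗g = refl
  ∑-cong (suc n) f≗g = cong₂ _+_ (f≗g 0 z<s) (∑-cong n (λ y y<n → f≗g (suc y) (s<s y<n)))

  ∑-const : ∀ n k → ∑ n (λ _ → k) ≡ n * k
  ∑-const zero    k = refl
  ∑-const (suc n) k = cong (k +_) (∑-const n k)

  ∑-zeros : ∀ n → ∑ n (λ _ → 0) ≡ 0
  ∑-zeros n = trans (∑-const n 0) (*-zeroʳ n)

  ∑-+ : ∀ n (f g : ℕ → ℕ) → ∑ n (λ y → f y + g y) ≡ ∑ n f + ∑ n g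
  ∑-+ zero    f g = refl
  ∑-+ (suc n) f g rewrite ∑-+ n (f ∘ suc) (g ∘ suc) =
    solve-∀-+ (f 0) (g 0) (∑ n (f ∘ suc)) (∑ n (g ∘ suc))
    where
    solve-∀-+ : ∀ p q r s → p + q + (r + s) ≡ p + r + (q + s)
    solve-∀-+ = solve-∀

  ∑-split : ∀ m n (f : ℕ → ℕ) → ∑ (m + n) f ≡ ∑ m f + ∑ n (λ y → f (m + y))
  ∑-split zero    n f = refl
  ∑-split (suc m) n f = trans (cong (f 0 +_) (∑-split m n (f ∘ suc))) (sym (+-assoc (f 0) _ _))

  ∑-if : ∀ n c (f g : ℕ → ℕ) → ∑ n (λ y → if c then f y else g y) ≡ (if c then ∑ n f else ∑ n g)
  ∑-if n true  f g = refl
  ∑-if n false f g = refl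

  ∑-≡ᵇ : ∀ n k (h : ℕ → ℕ) → ∑ n (λ y → if y ≡ᵇ k then h y else 0) ≡ (if k <ᵇ n then h k else 0)
  ∑-≡ᵇ zero    k       h = refl
  ∑-≡ᵇ (suc n) zero    h = trans (cong (h 0 +_) (∑-zeros n)) (+-identityʳ _)
  ∑-≡ᵇ (suc n) (suc k) h = ∑-≡ᵇ n k (h ∘ suc)

  ∑-<ᵇ : ∀ n t → t ≤ n → ∑ n (λ j → indicator (j <ᵇ t)) ≡ t
  ∑-<ᵇ zero    zero    _         = refl
  ∑-<ᵇ (suc n) zero    _         = ∑-zeros n
  ∑-<ᵇ (suc n) (suc t) (s≤s t≤n) = cong suc (∑-<ᵇ n t t≤n)

  ∑-≤ᵇ : ∀ n t → ∑ n (λ j → indicator (t <ᵇ suc j)) ≡ n ∸ t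
  ∑-≤ᵇ zero    t       = sym (0∸n≡0 t)
  ∑-≤ᵇ (suc n) zero    = cong suc (trans (∑-const n 1) (*-identityʳ n))
  ∑-≤ᵇ (suc n) (suc t) = ∑-≤ᵇ n t

  ∑-odd : ∀ n k → ∑ n (λ t → suc (t + t + k)) ≡ n * k + n * n
  ∑-odd zero    k = refl
  ∑-odd (suc n) k = trans (cong (suc k +_) (trans (∑-cong n λ t _ → shift t) (∑-odd n (2 + k))))
                          (solve-∀-odd n k)
    where
    shift : ∀ t → suc (suc t + suc t + k) ≡ suc (t + t + (2 + k))
    shift t = cong suc (solve-∀-shift t k)
      where
      solve-∀-shift : ∀ t k → suc t + suc t + k ≡ t + t + (2 + k)
      solve-∀-shift = solve-∀
    solve-∀-odd : ∀ n k → suc k + (n * (2 + k) + n * n) ≡ suc n * k + suc n * suc n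
    solve-∀-odd = solve-∀

  ∑-truncate : ∀ n (g : ℕ → ℕ) → ∑ (suc n) (λ j → if j <ᵇ n then g j else 0) ≡ ∑ n g
  ∑-truncate zero    g = refl
  ∑-truncate (suc n) g = cong (g 0 +_) (∑-truncate n (g ∘ suc))

  sum-tabulate : ∀ n (f : Fin n → ℕ) (h : ℕ → ℕ) → (∀ i → f i ≡ h (toℕ i)) → sum (tabulate f) ≡ ∑ n h
  sum-tabulate zero    f h f≗h = refl
  sum-tabulate (suc n) f h f≗h =
    cong₂ _+_ (f≗h Fin.zero) (sum-tabulate n (f ∘ Fin.suc) (h ∘ suc) (f≗h ∘ Fin.suc))
    where import Data.Fin as Fin

∑-≡ᵇ-else : ∀ n k x y → k < n → ∑ n (λ j → if j ≡ᵇ k then x else y) ≡ x + (n ∸ 1) * y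
∑-≡ᵇ-else (suc n) zero x y _ = trans (∑-suc n _) (cong (x +_) (∑-const n y))
∑-≡ᵇ-else (suc (suc n)) (suc k) x y (s<s k<n) =
  trans (∑-suc (suc n) _) (trans (cong (y +_) (∑-≡ᵇ-else (suc n) k x y k<n)) (solve-∀-swap x y (n * y)))
  where
  solve-∀-swap : ∀ x y z → y + (x + z) ≡ x + (y + z)
  solve-∀-swap = solve-∀

∑-blocks : ∀ m n (g : ℕ → ℕ) → ∑ (m * n) g ≡ ∑ m (λ i → ∑ n (λ j → g (j + i * n)))
∑-blocks zero    n g = trans (∑-empty g) (sym (∑-empty _))
∑-blocks (suc m) n g =
  trans (∑-split n (m * n) g)
  (trans (cong₂ _+_ (∑-cong n λ j _ → cong g (sym (+-identityʳ j)))
                    (trans (∑-blocks m n (λ y → g (n + y))) (∑-cong m λ i _ → ∑-cong n λ j _ → cong g (solve-∀-shift n j (i * n)))))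
         (sym (∑-suc m _)))
  where
  solve-∀-shift : ∀ n j k → n + (j + k) ≡ j + (n + k)
  solve-∀-shift = solve-∀

∑-≡ᵇ-< : ∀ n k (h : ℕ → ℕ) → k < n → ∑ n (λ y → if y ≡ᵇ k then h y else 0) ≡ h k
∑-≡ᵇ-< n k h k<n = trans (∑-≡ᵇ n k h) (if-cong (<⇒<ᵇ≡true k<n))

∑-∑-≡ᵇ : ∀ m n k (g : ℕ → ℕ → ℕ) → k < m →
         ∑ m (λ y → ∑ n (λ z → if y ≡ᵇ k then g y z else 0)) ≡ ∑ n (g k)
∑-∑-≡ᵇ m n k g k<m =
  trans (∑-cong m λ y _ → trans (∑-if n (y ≡ᵇ k) (g y) (λ _ → 0)) (if-cong-else (y ≡ᵇ k) (∑-zeros n)))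
        (∑-≡ᵇ-< m k (λ y → ∑ n (g y)) k<m)

antitone⇒last≤first : ∀ n (f : ℕ → ℕ) → (∀ t → t < n → f (suc t) ≤ f t) → f n ≤ f 0
antitone⇒last≤first zero    f _    = ≤-refl
antitone⇒last≤first (suc n) f anti =
  ≤-trans (antitone⇒last≤first n (f ∘ suc) (λ t t<n → anti (suc t) (s<s t<n))) (anti 0 z<s)

∑-telescope-antitone : ∀ n (f : ℕ → ℕ) → (∀ t → t < n → f (suc t) ≤ f t) →
                       ∑ n (λ t → ∣ f t - f (suc t) ∣) ≡ f 0 ∸ f n
∑-telescope-antitone zero    f _    = trans (∑-empty _) (sym (n∸n≡0 (f 0)))
∑-telescope-antitone (suc n) f anti = begin
    ∑ (suc n) (λ t → ∣ f t - f (suc t) ∣)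
  ≡⟨ ∑-suc n _ ⟩
    ∣ f 0 - f 1 ∣ + ∑ n (λ t → ∣ f (suc t) - f (2 + t) ∣)
  ≡⟨ cong₂ _+_ (m≤n⇒∣n-m∣≡n∸m (anti 0 z<s)) (∑-telescope-antitone n (f ∘ suc) anti′) ⟩
    (f 0 ∸ f 1) + (f 1 ∸ f (suc n))
  ≡⟨ [m∸n]+[n∸o]≡m∸o (anti 0 z<s) (antitone⇒last≤first n (f ∘ suc) anti′) ⟩
    f 0 ∸ f (suc n)
  ∎
  where
  open ≡-Reasoning
  anti′ : ∀ t → t < n → f (2 + t) ≤ f (suc t)
  anti′ t t<n = anti (suc t) (s<s t<n)

sum-allFin : ∀ n (f : Fin n → ℕ) (h : ℕ → ℕ) → (∀ i → f i ≡ h (toℕ i)) → sum (map f (allFin n)) ≡ ∑ n h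
sum-allFin n f h f≗h = trans (cong sum (map-tabulate (λ i → i) f)) (sum-tabulate n f h f≗h)

sum-concatMap : ∀ {A B : Set} (f : B → ℕ) (g : A → List B) xs →
  sum (map f (concatMap g xs)) ≡ sum (map (λ x → sum (map f (g x))) xs)
sum-concatMap f g []       = refl
sum-concatMap f g (x ∷ xs) =
  trans (cong sum (map-++ f (g x) (concatMap g xs)))
        (trans (sum-++ (map f (g x)) _) (cong (sum (map f (g x)) +_) (sum-concatMap f g xs)))

-- Graph distance

module _ (G : Graph) where
  open Graph G using (n; adj)

  count≡∑ : ∀ (P : Fin n → Bool) (p : ℕ → Bool) → (∀ v → P v ≡ p (toℕ v)) →
            count G P ≡ ∑ n (indicator ∘ p)
  count≡∑ P p P≗p = sum-allFin n _ _ (cong indicator ∘ P≗p)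

  sum-edges : ∀ (A : ℕ → ℕ → Bool) → (∀ u v → adj u v ≡ A (toℕ u) (toℕ v)) →
              ∀ (F : Fin n × Fin n → ℕ) (f : ℕ → ℕ → ℕ) → (∀ u v → F (u , v) ≡ f (toℕ u) (toℕ v)) →
              sum (map F (edges G)) ≡ ∑ n (λ x → ∑ n (λ y → if (x <ᵇ y) ∧ A x y then f x y else 0))
  sum-edges A adj≗A F f F≗f =
    trans (sum-concatMap F _ (vertices G)) $ sum-allFin n _ _ λ u →
    trans (sum-concatMap F _ (vertices G)) $ sum-allFin n _ _ λ v →
    trans (if-float (sum ∘ map F) ((toℕ u <ᵇ toℕ v) ∧ adj u v))
          (trans (if-cong (cong ((toℕ u <ᵇ toℕ v) ∧_) (adj≗A u v)))
                 (if-cong-then ((toℕ u <ᵇ toℕ v) ∧ A (toℕ u) (toℕ v)) (trans (+-identityʳ _) (F≗f u v))))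

record IsGraphDistance (G : Graph) (δ : Fin (Graph.n G) → Fin (Graph.n G) → ℕ) : Set where
  open Graph G using (n; adj)
  field
    δ-refl  : ∀ u → δ u u ≡ 0
    δ≡0⇒≡   : ∀ {u v} → δ u v ≡ 0 → u ≡ v
    δ-adj   : ∀ {u w} v → T (adj u w) → δ u v ≤ suc (δ w v)
    δ-step  : ∀ {u v k} → δ u v ≡ suc k → ∃[ w ] T (adj u w) × δ w v ≡ k
    δ<n     : ∀ u v → δ u v < n

module _ {G : Graph} {δ} (isDistance : IsGraphDistance G δ) where
  open Graph G using (n; adj)
  open IsGraphDistance isDistance

  within-sound : ∀ k u v → T (within G k u v) → δ u v ≤ k
  within-sound zero    u v u≡v = ≤-reflexive (trans (cong (δ u) (sym (toℕ-injective (≡ᵇ⇒≡ _ _ u≡v)))) (δ-refl u))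
  within-sound (suc k) u v uv-within with Equivalence.to T-∨ uv-within
  ... | inj₁ uv-within′ = m≤n⇒m≤1+n (within-sound k u v uv-within′)
  ... | inj₂ via-neighbour with satisfied (any⁻ _ (vertices G) via-neighbour)
  ...   | w , uw-adj∧wv-within with Equivalence.to T-∧ uw-adj∧wv-within
  ...     | uw-adj , wv-within = ≤-trans (δ-adj v uw-adj) (s≤s (within-sound k w v wv-within))

  within-complete : ∀ k u v → δ u v ≤ k → T (within G k u v)
  within-complete zero    u v δ≤0 = ≡⇒≡ᵇ _ _ (cong toℕ (δ≡0⇒≡ (n≤0⇒n≡0 δ≤0)))
  within-complete (suc k) u v δ≤1+k with δ u v ≤? k
  ... | yes δ≤k = Equivalence.from T-∨ (inj₁ (within-complete k u v δ≤k))
  ... | no δ≰k with δ-step (≤-antisym δ≤1+k (≰⇒> δ≰k))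
  ...   | w , uw-adj , δw≡k = Equivalence.from T-∨ (inj₂ (any⁺ _ (Any.map close (∈-allFin w))))
    where
    close : ∀ {x} → w ≡ x → T (adj u x ∧ within G k x v)
    close refl = Equivalence.from T-∧ (uw-adj , within-complete k w v (≤-reflexive δw≡k))

  distGo≡δ : ∀ f k u v → k ≤ δ u v → δ u v < k + f → distGo G k f u v ≡ δ u v
  distGo≡δ zero    k u v k≤δ δ<k+0 = ⊥-elim (<⇒≱ (subst (δ u v <_) (+-identityʳ k) δ<k+0) k≤δ)
  distGo≡δ (suc f) k u v k≤δ δ<k+1+f with within G k u v in eq
  ... | true  = ≤-antisym k≤δ (within-sound k u v (subst T (sym eq) tt))
  ... | false = distGo≡δ f (suc k) u v (≰⇒> (subst T eq ∘ within-complete k u v))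
                         (subst (δ u v <_) (+-suc k f) δ<k+1+f)

  dist≡δ : ∀ u v → dist G u v ≡ δ u v
  dist≡δ u v = distGo≡δ n 0 u v z≤n (δ<n u v)

-- The spider S_{a,b}, with a = 2 + a′ and b = 1 + c

module Spider (a′ c : ℕ) where
  a b N : ℕ
  a = 2 + a′
  b = suc c
  N = suc (a * b)

  -- vertex i e : the vertex of leg i at depth e; depth 0 is the centre, whatever i is.
  vertex : ℕ → ℕ → ℕ
  vertex i zero    = 0
  vertex i (suc j) = suc (j + i * b)

  leg depth : ℕ → ℕ
  leg zero    = 0
  leg (suc x) = x / b
  depth zero    = 0
  depth (suc x) = suc (x % b)

  vertex-leg-depth : ∀ x → vertex (leg x) (depth x) ≡ x
  vertex-leg-depth zero    = refl
  vertex-leg-depth (suc x) = cong suc (sym (m≡m%n+[m/n]*n x b))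

  leg<a : ∀ {x} → x < N → leg x < a
  leg<a {zero}  _          = z<s
  leg<a {suc x} (s<s x<ab) = m<n*o⇒m/o<n x<ab

  depth≤b : ∀ x → depth x ≤ b
  depth≤b zero    = z≤n
  depth≤b (suc x) = m%n<n x b

  vertex<N : ∀ {i e} → i < a → e ≤ b → vertex i e < N
  vertex<N {i} {zero}  _   _   = z<s
  vertex<N {i} {suc j} i<a j<b = s<s $ begin-strict
    j + i * b <⟨ +-monoˡ-< (i * b) j<b ⟩
    b + i * b ≤⟨ *-monoˡ-≤ b i<a ⟩
    a * b     ∎
    where open ≤-Reasoning

  [j+i*b]%b≡j : ∀ i {j} → j < b → (j + i * b) % b ≡ j
  [j+i*b]%b≡j i {j} j<b = trans ([m+kn]%n≡m%n j i b) (m<n⇒m%n≡m j<b)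

  [j+i*b]/b≡i : ∀ i {j} → j < b → (j + i * b) / b ≡ i
  [j+i*b]/b≡i i {j} j<b = sym (*-cancelʳ-≡ i _ b (+-cancelˡ-≡ j _ _ (begin
    j + i * b                               ≡⟨ m≡m%n+[m/n]*n (j + i * b) b ⟩
    (j + i * b) % b + ((j + i * b) / b) * b ≡⟨ cong (_+ ((j + i * b) / b) * b) ([j+i*b]%b≡j i j<b) ⟩
    j + ((j + i * b) / b) * b               ∎)))
    where open ≡-Reasoning

  b∣?[j+i*b] : ∀ i {j} → j < b → ⌊ b ∣? (j + i * b) ⌋ ≡ (j ≡ᵇ 0)
  b∣?[j+i*b] i {j} j<b = T-reflects-elim (fromEquivalence to from)
    where
    to : T ⌊ b ∣? (j + i * b) ⌋ → T (j ≡ᵇ 0)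
    to b∣ = ≡⇒≡ᵇ j 0 (trans (sym ([j+i*b]%b≡j i j<b)) (n∣m⇒m%n≡0 _ b (toWitness b∣)))
    from : T (j ≡ᵇ 0) → T ⌊ b ∣? (j + i * b) ⌋
    from j≡0 = fromWitness (divides i (cong (_+ i * b) (≡ᵇ⇒≡ j 0 j≡0)))

  vertex-≡ᵇ : ∀ i i′ {j j′} → j < b → j′ < b → (j + i * b ≡ᵇ j′ + i′ * b) ≡ ((i ≡ᵇ i′) ∧ (j ≡ᵇ j′))
  vertex-≡ᵇ i i′ {j} {j′} j<b j′<b = T-reflects-elim (fromEquivalence to from)
    where
    to : T (j + i * b ≡ᵇ j′ + i′ * b) → T ((i ≡ᵇ i′) ∧ (j ≡ᵇ j′))
    to eq = Equivalence.from T-∧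
      ( ≡⇒≡ᵇ i i′ (trans (sym ([j+i*b]/b≡i i j<b)) (trans (cong (_/ b) j+ib≡j′+i′b) ([j+i*b]/b≡i i′ j′<b)))
      , ≡⇒≡ᵇ j j′ (trans (sym ([j+i*b]%b≡j i j<b)) (trans (cong (_% b) j+ib≡j′+i′b) ([j+i*b]%b≡j i′ j′<b))))
      where
      j+ib≡j′+i′b : j + i * b ≡ j′ + i′ * b
      j+ib≡j′+i′b = ≡ᵇ⇒≡ (j + i * b) (j′ + i′ * b) eq
    from : T ((i ≡ᵇ i′) ∧ (j ≡ᵇ j′)) → T (j + i * b ≡ᵇ j′ + i′ * b)
    from eqs with Equivalence.to T-∧ eqs
    ... | i≡i′ , j≡j′ = ≡⇒≡ᵇ _ _ (cong₂ (λ i j → j + i * b) (≡ᵇ⇒≡ i i′ i≡i′) (≡ᵇ⇒≡ j j′ j≡j′))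

  adjacent : ℕ → ℕ → Bool
  adjacent = spiderAdjSymℕ b

  centre-adj : ∀ i {j} → j < b → spiderAdjℕ b 0 (vertex i (suc j)) ≡ (j ≡ᵇ 0)
  centre-adj i j<b = b∣?[j+i*b] i j<b

  leg-adj : ∀ i i′ {j j′} → j < b → j′ < b →
            spiderAdjℕ b (vertex i (suc j)) (vertex i′ (suc j′)) ≡ ((i′ ≡ᵇ i) ∧ (j′ ≡ᵇ suc j))
  leg-adj i i′ {j} {j′} j<b j′<b with suc j <? b
  ... | yes 1+j<b = begin
      (j′ + i′ * b ≡ᵇ suc j + i * b) ∧ not ⌊ b ∣? (suc j + i * b) ⌋
    ≡⟨ cong (λ d → (j′ + i′ * b ≡ᵇ suc j + i * b) ∧ not d) (b∣?[j+i*b] i 1+j<b) ⟩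
      (j′ + i′ * b ≡ᵇ suc j + i * b) ∧ true
    ≡⟨ ∧-identityʳ _ ⟩
      (j′ + i′ * b ≡ᵇ suc j + i * b)
    ≡⟨ vertex-≡ᵇ i′ i j′<b 1+j<b ⟩
      (i′ ≡ᵇ i) ∧ (j′ ≡ᵇ suc j)
    ∎
    where open ≡-Reasoning
  ... | no 1+j≮b = begin
      (j′ + i′ * b ≡ᵇ suc j + i * b) ∧ not ⌊ b ∣? (suc j + i * b) ⌋
    ≡⟨ cong (λ d → (j′ + i′ * b ≡ᵇ suc j + i * b) ∧ not d) b∣1+j+ib ⟩
      (j′ + i′ * b ≡ᵇ suc j + i * b) ∧ false
    ≡⟨ ∧-zeroʳ _ ⟩
      false
    ≡⟨ ∧-zeroʳ (i′ ≡ᵇ i) ⟨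
      (i′ ≡ᵇ i) ∧ false
    ≡⟨ cong ((i′ ≡ᵇ i) ∧_) (≢⇒≡ᵇ≡false j′≢1+j) ⟨
      (i′ ≡ᵇ i) ∧ (j′ ≡ᵇ suc j)
    ∎
    where
    open ≡-Reasoning
    1+j≡b : suc j ≡ b
    1+j≡b = ≤-antisym j<b (≮⇒≥ 1+j≮b)
    b∣1+j+ib : ⌊ b ∣? (suc j + i * b) ⌋ ≡ true
    b∣1+j+ib = Equivalence.to T-≡ (fromWitness (divides (suc i) (cong (_+ i * b) 1+j≡b)))
    j′≢1+j : j′ ≢ suc j
    j′≢1+j j′≡1+j = <-irrefl (trans j′≡1+j 1+j≡b) j′<b

  spiderAdj-outward : ∀ i {t} → t < b → T (spiderAdjℕ b (vertex i t) (vertex i (suc t)))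
  spiderAdj-outward i {zero}  0<b   = Equivalence.from T-≡ (centre-adj i 0<b)
  spiderAdj-outward i {suc j} 1+j<b rewrite leg-adj i i (<-trans (n<1+n j) 1+j<b) 1+j<b
                                          | ≡ᵇ-refl i | ≡ᵇ-refl j = tt

  adjacent-outward : ∀ i {t} → t < b → T (adjacent (vertex i t) (vertex i (suc t)))
  adjacent-outward i t<b = Equivalence.from T-∨ (inj₁ (spiderAdj-outward i t<b))

  adjacent-inward : ∀ i {t} → t < b → T (adjacent (vertex i (suc t)) (vertex i t))
  adjacent-inward i t<b = Equivalence.from T-∨ (inj₂ (spiderAdj-outward i t<b))

  spiderAdj⇒< : ∀ x y → T (spiderAdjℕ b x y) → x < y
  spiderAdj⇒< zero    (suc y) _   = z<s
  spiderAdj⇒< (suc x) y       x→y =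
    subst (suc x <_) (sym (≡ᵇ⇒≡ y (2 + x) (proj₁ (Equivalence.to T-∧ x→y)))) (n<1+n (suc x))

  <ᵇ∧adjacent : ∀ x y → ((x <ᵇ y) ∧ adjacent x y) ≡ spiderAdjℕ b x y
  <ᵇ∧adjacent x y = T-reflects-elim (fromEquivalence to from)
    where
    to : T ((x <ᵇ y) ∧ adjacent x y) → T (spiderAdjℕ b x y)
    to x<y∧x~y with Equivalence.to T-∧ x<y∧x~y
    ... | x<y , x~y with Equivalence.to T-∨ x~y
    ...   | inj₁ x→y = x→y
    ...   | inj₂ y→x = ⊥-elim (<-asym (<ᵇ⇒< x y x<y) (spiderAdj⇒< y x y→x))
    from : T (spiderAdjℕ b x y) → T ((x <ᵇ y) ∧ adjacent x y)
    from x→y = Equivalence.from T-∧ (<⇒<ᵇ (spiderAdj⇒< x y x→y) , Equivalence.from T-∨ (inj₁ x→y))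

  record LegEdge (x y : ℕ) : Set where
    constructor legEdge
    field
      i t : ℕ
      t<b : t < b
      x≡  : x ≡ vertex i t
      y≡  : y ≡ vertex i (suc t)

  spiderAdj⇒LegEdge : ∀ x y → T (spiderAdjℕ b x y) → LegEdge x y
  spiderAdj⇒LegEdge zero    (suc y) b∣y = legEdge (y / b) 0 z<s refl (cong suc y≡)
    where
    y≡ : y ≡ 0 + (y / b) * b
    y≡ = trans (m≡m%n+[m/n]*n y b) (cong (_+ (y / b) * b) (n∣m⇒m%n≡0 y b (toWitness b∣y)))
  spiderAdj⇒LegEdge (suc x) y       x→y =
    legEdge (x / b) (suc (x % b)) 1+x%b<b (cong suc x≡) (trans y≡2+x (cong (suc ∘ suc) x≡))
    where
    x≡ : x ≡ x % b + (x / b) * b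
    x≡ = m≡m%n+[m/n]*n x b
    y≡2+x : y ≡ 2 + x
    y≡2+x = ≡ᵇ⇒≡ y (2 + x) (proj₁ (Equivalence.to T-∧ x→y))
    1+x%b<b : suc (x % b) < b
    1+x%b<b with suc (x % b) <? b
    ... | yes 1+x%b<b = 1+x%b<b
    ... | no  1+x%b≮b = ⊥-elim (subst T (Equivalence.to T-not-≡ b∤1+x) (fromWitness b∣1+x))
      where
      b∤1+x : T (not ⌊ b ∣? suc x ⌋)
      b∤1+x = proj₂ (Equivalence.to (T-∧ {y ≡ᵇ 2 + x}) x→y)
      b∣1+x : b ∣ suc x
      b∣1+x = divides (suc (x / b))
        (trans (cong suc x≡) (cong (_+ (x / b) * b) (≤-antisym (m%n<n x b) (≮⇒≥ 1+x%b≮b))))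

  legDist : ℕ → ℕ → ℕ → ℕ → ℕ
  legDist i e i′ t = if i ≡ᵇ i′ then ∣ e - t ∣ else e + t

  spiderDist : ℕ → ℕ → ℕ
  spiderDist x y = legDist (leg x) (depth x) (leg y) (depth y)

  legDist-centreˡ : ∀ i i′ t → legDist i 0 i′ t ≡ t
  legDist-centreˡ i i′ t = if-eta (i ≡ᵇ i′)

  legDist-centreʳ : ∀ i e i′ → legDist i e i′ 0 ≡ e
  legDist-centreʳ i e i′ = trans (if-cong₂ (i ≡ᵇ i′) (∣-∣-identityʳ e) (+-identityʳ e)) (if-eta (i ≡ᵇ i′))

  spiderDist-vertexˡ : ∀ i {e} y → e ≤ b → spiderDist (vertex i e) y ≡ legDist i e (leg y) (depth y)
  spiderDist-vertexˡ i {zero}  y _   = trans (legDist-centreˡ 0 (leg y) (depth y)) (sym (legDist-centreˡ i (leg y) (depth y)))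
  spiderDist-vertexˡ i {suc j} y j<b rewrite [j+i*b]/b≡i i j<b | [j+i*b]%b≡j i j<b = refl

  spiderDist-vertex : ∀ i i′ {e t} → e ≤ b → t ≤ b → spiderDist (vertex i e) (vertex i′ t) ≡ legDist i e i′ t
  spiderDist-vertex i i′ {e} {zero}  e≤b _ =
    trans (spiderDist-vertexˡ i 0 e≤b) (trans (legDist-centreʳ i e 0) (sym (legDist-centreʳ i e i′)))
  spiderDist-vertex i i′ {e} {suc j} e≤b j<b rewrite spiderDist-vertexˡ i (vertex i′ (suc j)) e≤b
                                                   | [j+i*b]/b≡i i′ j<b | [j+i*b]%b≡j i′ j<b = refl

  spiderDist-refl : ∀ x → spiderDist x x ≡ 0
  spiderDist-refl x rewrite ≡ᵇ-refl (leg x) = ∣n-n∣≡0 (depth x)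

  spiderDist≡0⇒≡ : ∀ {x y} → spiderDist x y ≡ 0 → x ≡ y
  spiderDist≡0⇒≡ {x} {y} d≡0 with leg x ≡ᵇ leg y in same-leg
  ... | true  = begin
    x                              ≡⟨ vertex-leg-depth x ⟨
    vertex (leg x) (depth x)       ≡⟨ cong₂ vertex (≡ᵇ⇒≡ _ _ (Equivalence.from T-≡ same-leg)) (∣m-n∣≡0⇒m≡n d≡0) ⟩
    vertex (leg y) (depth y)       ≡⟨ vertex-leg-depth y ⟩
    y                              ∎
    where open ≡-Reasoning
  ... | false = trans (trans (sym (vertex-leg-depth x)) (cong (vertex (leg x)) (m+n≡0⇒m≡0 (depth x) d≡0)))
                      (sym (trans (sym (vertex-leg-depth y)) (cong (vertex (leg y)) (m+n≡0⇒n≡0 (depth x) d≡0))))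

  legDist-inward : ∀ i t i′ e → legDist i (suc t) i′ e ≤ suc (legDist i t i′ e)
  legDist-inward i t i′ e with i ≡ᵇ i′
  ... | true  = ∣1+m-n∣≤1+∣m-n∣ t e
  ... | false = ≤-refl

  legDist-outward : ∀ i t i′ e → legDist i t i′ e ≤ suc (legDist i (suc t) i′ e)
  legDist-outward i t i′ e with i ≡ᵇ i′
  ... | true  = ∣m-n∣≤1+∣1+m-n∣ t e
  ... | false = ≤-trans (n≤1+n _) (n≤1+n _)

  spiderDist-adj : ∀ {x w} y → T (adjacent x w) → spiderDist x y ≤ suc (spiderDist w y)
  spiderDist-adj {x} {w} y x~w with Equivalence.to T-∨ x~w
  ... | inj₁ x→w with spiderAdj⇒LegEdge x w x→w
  ...   | legEdge i t t<b refl refl rewrite spiderDist-vertexˡ i y (<⇒≤ t<b) | spiderDist-vertexˡ i y t<b =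
          legDist-outward i t (leg y) (depth y)
  spiderDist-adj {x} {w} y x~w | inj₂ w→x with spiderAdj⇒LegEdge w x w→x
  ...   | legEdge i t t<b refl refl rewrite spiderDist-vertexˡ i y (<⇒≤ t<b) | spiderDist-vertexˡ i y t<b =
          legDist-inward i t (leg y) (depth y)

  legDist-step : ∀ {i e i′ t k} → i < a → i′ < a → e ≤ b → t ≤ b → legDist i e i′ t ≡ suc k →
                 ∃[ j ] ∃[ d ] j < a × d ≤ b × T (adjacent (vertex i e) (vertex j d)) × legDist j d i′ t ≡ k
  legDist-step {i} {e} {i′} {t} {k} i<a i′<a e≤b t≤b d≡1+k with i ≡ᵇ i′ in same-leg
  ... | true with ≡ᵇ⇒≡ i i′ (Equivalence.from T-≡ same-leg)
  ...   | refl with <-cmp e t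
  ...     | tri< e<t _ _ = i , suc e , i<a , <-≤-trans e<t t≤b , adjacent-outward i (<-≤-trans e<t t≤b) ,
                           trans (if-cong same-leg) (∣m-n∣≡1+k⇒∣1+m-n∣≡k e<t d≡1+k)
  ...     | tri≈ _ refl _ = ⊥-elim (0≢1+n (trans (sym (∣n-n∣≡0 e)) d≡1+k))
  legDist-step {i} {suc e} {_} {t} i<a _ e<b _ d≡1+k | true | refl | tri> _ _ t<1+e =
    i , e , i<a , <⇒≤ e<b , adjacent-inward i e<b , trans (if-cong same-leg) (∣1+m-n∣≡1+k⇒∣m-n∣≡k t<1+e d≡1+k)
  legDist-step {i} {suc e} {i′} {t} i<a _ e<b _ d≡1+k | false =
    i , e , i<a , <⇒≤ e<b , adjacent-inward i e<b , trans (if-cong same-leg) (suc-injective d≡1+k)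
  legDist-step {i} {zero} {i′} {suc t} _ i′<a _ _ refl | false =
    i′ , 1 , i′<a , s≤s z≤n , adjacent-outward i′ z<s , if-cong (≡ᵇ-refl i′)

  spiderDist-step : ∀ {x y k} → x < N → y < N → spiderDist x y ≡ suc k →
                    ∃[ w ] w < N × T (adjacent x w) × spiderDist w y ≡ k
  spiderDist-step {x} {y} x<N y<N d≡1+k
    with legDist-step (leg<a x<N) (leg<a y<N) (depth≤b x) (depth≤b y) d≡1+k
  ... | j , d , j<a , d≤b , x~w , d≡k =
    vertex j d , vertex<N j<a d≤b , subst (λ x → T (adjacent x (vertex j d))) (vertex-leg-depth x) x~w ,
    trans (spiderDist-vertexˡ j y d≤b) d≡k

  legDist≤+ : ∀ i e i′ t → legDist i e i′ t ≤ e + t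
  legDist≤+ i e i′ t with i ≡ᵇ i′
  ... | true  = ≤-trans (∣m-n∣≤m⊔n e t) (m⊔n≤m+n e t)
  ... | false = ≤-refl

  spiderDist<N : ∀ x y → spiderDist x y < N
  spiderDist<N x y = s≤s $ begin
    spiderDist x y     ≤⟨ legDist≤+ (leg x) (depth x) (leg y) (depth y) ⟩
    depth x + depth y  ≤⟨ +-mono-≤ (depth≤b x) (depth≤b y) ⟩
    b + b              ≤⟨ +-monoʳ-≤ b (m≤m+n b (a′ * b)) ⟩
    a * b              ∎
    where open ≤-Reasoning

  S : Graph
  S = spider a b

  spiderDist-isGraphDistance : IsGraphDistance S (λ u v → spiderDist (toℕ u) (toℕ v))
  spiderDist-isGraphDistance = record
    { δ-refl = spiderDist-refl ∘ toℕ
    ; δ≡0⇒≡  = toℕ-injective ∘ spiderDist≡0⇒≡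
    ; δ-adj  = λ {u} {w} v → spiderDist-adj {toℕ u} {toℕ w} (toℕ v)
    ; δ-step = step
    ; δ<n    = λ u v → spiderDist<N (toℕ u) (toℕ v)
    }
    where
    step : ∀ {u v k} → spiderDist (toℕ u) (toℕ v) ≡ suc k →
           ∃[ w ] T (adjacent (toℕ u) (toℕ w)) × spiderDist (toℕ w) (toℕ v) ≡ k
    step {u} {v} d≡1+k with spiderDist-step (toℕ<n u) (toℕ<n v) d≡1+k
    ... | w , w<N , u~w , d≡k = fromℕ< w<N ,
      subst (T ∘ adjacent (toℕ u)) (sym (toℕ-fromℕ< w<N)) u~w ,
      subst (λ w → spiderDist w (toℕ v) ≡ _) (sym (toℕ-fromℕ< w<N)) d≡k

  dist-spider : ∀ u v → dist S u v ≡ spiderDist (toℕ u) (toℕ v)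
  dist-spider = dist≡δ spiderDist-isGraphDistance

  ∑-vertices : ∀ (h : ℕ → ℕ) → ∑ N h ≡ h 0 + ∑ a (λ i → ∑ b (λ j → h (vertex i (suc j))))
  ∑-vertices h = trans (∑-suc (a * b) h) (cong (h 0 +_) (∑-blocks a b (h ∘ suc)))

  ∑-out-centre : ∀ (F : ℕ → ℕ) → ∑ N (λ y → if spiderAdjℕ b 0 y then F y else 0) ≡ ∑ a (λ i → F (vertex i 1))
  ∑-out-centre F = trans (∑-vertices _) (∑-cong a λ i _ →
    trans (∑-cong b λ j j<b → if-cong (centre-adj i j<b)) (∑-≡ᵇ-< b 0 _ z<s))

  ∑-out-leg : ∀ (F : ℕ → ℕ) i {j} → i < a → j < b →
              ∑ N (λ y → if spiderAdjℕ b (vertex i (suc j)) y then F y else 0) ≡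
              (if j <ᵇ c then F (vertex i (2 + j)) else 0)
  ∑-out-leg F i {j} i<a j<b = begin
      ∑ N (λ y → if spiderAdjℕ b (vertex i (suc j)) y then F y else 0)
    ≡⟨ ∑-vertices _ ⟩
      ∑ a (λ i′ → ∑ b (λ j′ →
        if spiderAdjℕ b (vertex i (suc j)) (vertex i′ (suc j′)) then F (vertex i′ (suc j′)) else 0))
    ≡⟨ ∑-cong a (λ i′ _ → ∑-cong b λ j′ j′<b → trans (if-cong (leg-adj i i′ j<b j′<b)) (if-∧ (i′ ≡ᵇ i))) ⟩
      ∑ a (λ i′ → ∑ b (λ j′ → if i′ ≡ᵇ i then (if j′ ≡ᵇ suc j then F (vertex i′ (suc j′)) else 0) else 0))
    ≡⟨ ∑-∑-≡ᵇ a b i _ i<a ⟩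
      ∑ b (λ j′ → if j′ ≡ᵇ suc j then F (vertex i (suc j′)) else 0)
    ≡⟨ ∑-≡ᵇ b (suc j) _ ⟩
      (if j <ᵇ c then F (vertex i (2 + j)) else 0)
    ∎
    where open ≡-Reasoning

  ∑-in-centre : ∑ N (λ y → indicator (spiderAdjℕ b y 0)) ≡ 0
  ∑-in-centre = trans (∑-cong N λ { zero _ → refl ; (suc y) _ → refl }) (∑-zeros N)

  ∑-in-leg : ∀ i {j} → i < a → j < b → ∑ N (λ y → indicator (spiderAdjℕ b y (vertex i (suc j)))) ≡ 1
  ∑-in-leg i {j} i<a j<b = begin
      ∑ N (λ y → indicator (spiderAdjℕ b y (vertex i (suc j))))
    ≡⟨ ∑-vertices _ ⟩
      indicator (spiderAdjℕ b 0 (vertex i (suc j))) +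
      ∑ a (λ i′ → ∑ b (λ j′ → indicator (spiderAdjℕ b (vertex i′ (suc j′)) (vertex i (suc j)))))
    ≡⟨ cong₂ _+_ (cong indicator (centre-adj i j<b)) (∑-cong a λ i′ _ → ∑-cong b λ j′ j′<b →
         trans (cong indicator (trans (leg-adj i′ i j′<b j<b) (cong (_∧ (j ≡ᵇ suc j′)) (≡ᵇ-sym i i′)))) (if-∧ (i′ ≡ᵇ i))) ⟩
      indicator (j ≡ᵇ 0) + ∑ a (λ i′ → ∑ b (λ j′ → if i′ ≡ᵇ i then indicator (j ≡ᵇ suc j′) else 0))
    ≡⟨ cong (indicator (j ≡ᵇ 0) +_) (∑-∑-≡ᵇ a b i _ i<a) ⟩
      indicator (j ≡ᵇ 0) + ∑ b (λ j′ → indicator (j ≡ᵇ suc j′))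
    ≡⟨ predecessors j j<b ⟩
      1
    ∎
    where
    open ≡-Reasoning
    predecessors : ∀ j → j < b → indicator (j ≡ᵇ 0) + ∑ b (λ j′ → indicator (j ≡ᵇ suc j′)) ≡ 1
    predecessors zero    _     = cong suc (∑-zeros b)
    predecessors (suc j) 1+j<b =
      trans (∑-cong b λ j′ _ → cong indicator (≡ᵇ-sym j j′)) (∑-≡ᵇ-< b j _ (<-trans (n<1+n j) 1+j<b))

  deg : ℕ → ℕ
  deg x = ∑ N (λ y → indicator (adjacent x y))

  deg≡out+in : ∀ x → deg x ≡ ∑ N (λ y → indicator (spiderAdjℕ b x y)) +
                               ∑ N (λ y → indicator (spiderAdjℕ b y x))
  deg≡out+in x = trans (∑-cong N λ y _ → indicator-∨ _ _ (not-both y)) (∑-+ N _ _)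
    where
    not-both : ∀ y → ¬ (T (spiderAdjℕ b x y) × T (spiderAdjℕ b y x))
    not-both y (x→y , y→x) = <-asym (spiderAdj⇒< x y x→y) (spiderAdj⇒< y x y→x)

  deg-centre : deg 0 ≡ a
  deg-centre = begin
      deg 0
    ≡⟨ deg≡out+in 0 ⟩
      ∑ N (indicator ∘ spiderAdjℕ b 0) + ∑ N (λ y → indicator (spiderAdjℕ b y 0))
    ≡⟨ cong₂ _+_ (∑-out-centre (λ _ → 1)) ∑-in-centre ⟩
      ∑ a (λ _ → 1) + 0
    ≡⟨ trans (+-identityʳ _) (trans (∑-const a 1) (*-identityʳ a)) ⟩
      a
    ∎
    where open ≡-Reasoning

  deg-leg : ∀ i {j} → i < a → j < b → deg (vertex i (suc j)) ≡ suc (indicator (j <ᵇ c))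
  deg-leg i {j} i<a j<b = begin
      deg (vertex i (suc j))
    ≡⟨ deg≡out+in (vertex i (suc j)) ⟩
      ∑ N (indicator ∘ spiderAdjℕ b (vertex i (suc j))) + ∑ N (λ y → indicator (spiderAdjℕ b y (vertex i (suc j))))
    ≡⟨ cong₂ _+_ (∑-out-leg (λ _ → 1) i i<a j<b) (∑-in-leg i i<a j<b) ⟩
      indicator (j <ᵇ c) + 1
    ≡⟨ +-comm (indicator (j <ᵇ c)) 1 ⟩
      suc (indicator (j <ᵇ c))
    ∎
    where open ≡-Reasoning

  ∑-edges : ∀ (f : ℕ → ℕ → ℕ) →
            ∑ N (λ x → ∑ N (λ y → if (x <ᵇ y) ∧ adjacent x y then f x y else 0)) ≡
            ∑ a (λ i → ∑ b (λ t → f (vertex i t) (vertex i (suc t))))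
  ∑-edges f = begin
      ∑ N (λ x → ∑ N (λ y → if (x <ᵇ y) ∧ adjacent x y then f x y else 0))
    ≡⟨ ∑-cong N (λ x _ → ∑-cong N λ y _ → if-cong (<ᵇ∧adjacent x y)) ⟩
      ∑ N (λ x → ∑ N (λ y → if spiderAdjℕ b x y then f x y else 0))
    ≡⟨ ∑-vertices _ ⟩
      ∑ N (λ y → if spiderAdjℕ b 0 y then f 0 y else 0) +
      ∑ a (λ i → ∑ b (λ j → ∑ N (λ y → if spiderAdjℕ b (vertex i (suc j)) y then f (vertex i (suc j)) y else 0)))
    ≡⟨ cong₂ _+_ (∑-out-centre (f 0)) (∑-cong a λ i i<a →
         trans (∑-cong b λ j j<b → ∑-out-leg (f (vertex i (suc j))) i i<a j<b) (∑-truncate c _)) ⟩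
      ∑ a (λ i → f 0 (vertex i 1)) + ∑ a (λ i → ∑ c (λ j → f (vertex i (suc j)) (vertex i (2 + j))))
    ≡⟨ ∑-+ a _ _ ⟨
      ∑ a (λ i → f 0 (vertex i 1) + ∑ c (λ j → f (vertex i (suc j)) (vertex i (2 + j))))
    ≡⟨ ∑-cong a (λ i _ → ∑-suc c (λ t → f (vertex i t) (vertex i (suc t)))) ⟨
      ∑ a (λ i → ∑ b (λ t → f (vertex i t) (vertex i (suc t))))
    ∎
    where open ≡-Reasoning

  degree≡deg : ∀ u → degree S u ≡ deg (toℕ u)
  degree≡deg u = count≡∑ S _ (adjacent (toℕ u)) (λ _ → refl)

  irr≡∑-legs : irr S ≡ ∑ a (λ i → ∑ b (λ t → ∣ deg (vertex i t) - deg (vertex i (suc t)) ∣))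
  irr≡∑-legs = trans (sum-edges S adjacent (λ _ _ → refl) _ (λ x y → ∣ deg x - deg y ∣)
                                (λ u v → cong₂ ∣_-_∣ (degree≡deg u) (degree≡deg v)))
                     (∑-edges _)

  -- Along a leg the degrees a, 2, …, 2, 1 decrease, so the sum telescopes to a - 1.
  ∑-leg-irr : ∀ i → i < a → ∑ b (λ t → ∣ deg (vertex i t) - deg (vertex i (suc t)) ∣) ≡ a ∸ 1
  ∑-leg-irr i i<a = begin
      ∑ b (λ t → ∣ deg (vertex i t) - deg (vertex i (suc t)) ∣)
    ≡⟨ ∑-telescope-antitone b (deg ∘ vertex i) antitone ⟩
      deg 0 ∸ deg (vertex i b)
    ≡⟨ cong₂ _∸_ deg-centre (trans (deg-leg i i<a ≤-refl) (cong (suc ∘ indicator) (≤⇒>ᵇ≡false {c} ≤-refl))) ⟩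
      a ∸ 1
    ∎
    where
    open ≡-Reasoning
    deg≤2 : ∀ {j} → j < b → deg (vertex i (suc j)) ≤ 2
    deg≤2 {j} j<b = ≤-trans (≤-reflexive (deg-leg i i<a j<b)) (s≤s (indicator≤1 (j <ᵇ c)))
    deg≡2 : ∀ {j} → j < c → deg (vertex i (suc j)) ≡ 2
    deg≡2 j<c = trans (deg-leg i i<a (m<n⇒m<1+n j<c)) (cong (suc ∘ indicator) (<⇒<ᵇ≡true j<c))
    antitone : ∀ t → t < b → deg (vertex i (suc t)) ≤ deg (vertex i t)
    antitone zero    0<b   = ≤-trans (deg≤2 0<b) (subst (2 ≤_) (sym deg-centre) (s≤s (s≤s z≤n)))
    antitone (suc j) 1+j<b = ≤-trans (deg≤2 1+j<b) (≤-reflexive (sym (deg≡2 (s<s⁻¹ 1+j<b))))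

  irr-spider : irr S ≡ a * (a ∸ 1)
  irr-spider = trans irr≡∑-legs (trans (∑-cong a ∑-leg-irr) (∑-const a (a ∸ 1)))

  closer : ℕ → ℕ → ℕ
  closer x y = ∑ N (λ z → indicator (spiderDist z x <ᵇ spiderDist z y))

  nCloser≡closer : ∀ u v → nCloser S u v ≡ closer (toℕ u) (toℕ v)
  nCloser≡closer u v = count≡∑ S _ _ (λ w → cong₂ _<ᵇ_ (dist-spider w u) (dist-spider w v))

  mostar≡∑-legs : mostar S ≡ ∑ a (λ i → ∑ b (λ t →
                    ∣ closer (vertex i t) (vertex i (suc t)) - closer (vertex i (suc t)) (vertex i t) ∣))
  mostar≡∑-legs = trans (sum-edges S adjacent (λ _ _ → refl) _ (λ x y → ∣ closer x y - closer y x ∣)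
                                   (λ u v → cong₂ ∣_-_∣ (nCloser≡closer u v) (nCloser≡closer v u)))
                        (∑-edges _)

  -- The inner end of an edge is closer for the centre, the t vertices of the same leg below it
  -- and all (a - 1) b vertices of the other legs.
  closer-inward : ∀ i {t} → i < a → t < b → closer (vertex i t) (vertex i (suc t)) ≡ suc (t + (a ∸ 1) * b)
  closer-inward i {t} i<a t<b = begin
      closer (vertex i t) (vertex i (suc t))
    ≡⟨ ∑-vertices _ ⟩
      indicator (spiderDist 0 (vertex i t) <ᵇ spiderDist 0 (vertex i (suc t))) +
      ∑ a (λ i′ → ∑ b (λ j′ → indicator (spiderDist (vertex i′ (suc j′)) (vertex i t)
                                          <ᵇ spiderDist (vertex i′ (suc j′)) (vertex i (suc t)))))
    ≡⟨ cong₂ _+_ centre (∑-cong a λ i′ _ → ∑-cong b λ j′ j′<b → trans (cong indicator (cong₂ _<ᵇ_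
         (spiderDist-vertex i′ i j′<b (<⇒≤ t<b)) (spiderDist-vertex i′ i j′<b t<b))) (pointwise i′ j′)) ⟩
      1 + ∑ a (λ i′ → ∑ b (λ j′ → if i′ ≡ᵇ i then indicator (j′ <ᵇ t) else 1))
    ≡⟨ cong suc (∑-cong a λ i′ _ → ∑-if b (i′ ≡ᵇ i) _ _) ⟩
      1 + ∑ a (λ i′ → if i′ ≡ᵇ i then ∑ b (λ j′ → indicator (j′ <ᵇ t)) else ∑ b (λ _ → 1))
    ≡⟨ cong suc (∑-≡ᵇ-else a i _ _ i<a) ⟩
      1 + (∑ b (λ j′ → indicator (j′ <ᵇ t)) + (a ∸ 1) * ∑ b (λ _ → 1))
    ≡⟨ cong suc (cong₂ _+_ (∑-<ᵇ b t (<⇒≤ t<b)) (cong ((a ∸ 1) *_) (trans (∑-const b 1) (*-identityʳ b)))) ⟩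
      suc (t + (a ∸ 1) * b)
    ∎
    where
    open ≡-Reasoning
    centre : indicator (spiderDist 0 (vertex i t) <ᵇ spiderDist 0 (vertex i (suc t))) ≡ 1
    centre rewrite spiderDist-vertex 0 i z≤n (<⇒≤ t<b) | spiderDist-vertex 0 i z≤n t<b
                 | legDist-centreˡ 0 i t | legDist-centreˡ 0 i (suc t) = cong indicator (<⇒<ᵇ≡true (n<1+n t))
    pointwise : ∀ i′ j′ → indicator (legDist i′ (suc j′) i t <ᵇ legDist i′ (suc j′) i (suc t)) ≡
                          (if i′ ≡ᵇ i then indicator (j′ <ᵇ t) else 1)
    pointwise i′ j′ with i′ ≡ᵇ i
    ... | true  = cong indicator (∣m-n∣<ᵇ∣m-1+n∣ (suc j′) t)
    ... | false = cong indicator (<⇒<ᵇ≡true (+-monoʳ-< (suc j′) (n<1+n t)))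

  -- The outer end is closer exactly for the b - t vertices beyond it on its leg.
  closer-outward : ∀ i {t} → i < a → t < b → closer (vertex i (suc t)) (vertex i t) ≡ b ∸ t
  closer-outward i {t} i<a t<b = begin
      closer (vertex i (suc t)) (vertex i t)
    ≡⟨ ∑-vertices _ ⟩
      indicator (spiderDist 0 (vertex i (suc t)) <ᵇ spiderDist 0 (vertex i t)) +
      ∑ a (λ i′ → ∑ b (λ j′ → indicator (spiderDist (vertex i′ (suc j′)) (vertex i (suc t))
                                          <ᵇ spiderDist (vertex i′ (suc j′)) (vertex i t))))
    ≡⟨ cong₂ _+_ centre (∑-cong a λ i′ _ → ∑-cong b λ j′ j′<b → trans (cong indicator (cong₂ _<ᵇ_
         (spiderDist-vertex i′ i j′<b t<b) (spiderDist-vertex i′ i j′<b (<⇒≤ t<b)))) (pointwise i′ j′)) ⟩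
      0 + ∑ a (λ i′ → ∑ b (λ j′ → if i′ ≡ᵇ i then indicator (t <ᵇ suc j′) else 0))
    ≡⟨ ∑-∑-≡ᵇ a b i _ i<a ⟩
      ∑ b (λ j′ → indicator (t <ᵇ suc j′))
    ≡⟨ ∑-≤ᵇ b t ⟩
      b ∸ t
    ∎
    where
    open ≡-Reasoning
    centre : indicator (spiderDist 0 (vertex i (suc t)) <ᵇ spiderDist 0 (vertex i t)) ≡ 0
    centre rewrite spiderDist-vertex 0 i z≤n (<⇒≤ t<b) | spiderDist-vertex 0 i z≤n t<b
                 | legDist-centreˡ 0 i t | legDist-centreˡ 0 i (suc t) = cong indicator (≤⇒>ᵇ≡false (n≤1+n t))
    pointwise : ∀ i′ j′ → indicator (legDist i′ (suc j′) i (suc t) <ᵇ legDist i′ (suc j′) i t) ≡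
                          (if i′ ≡ᵇ i then indicator (t <ᵇ suc j′) else 0)
    pointwise i′ j′ with i′ ≡ᵇ i
    ... | true  = cong indicator (∣m-1+n∣<ᵇ∣m-n∣ (suc j′) t)
    ... | false = cong indicator (≤⇒>ᵇ≡false (<⇒≤ (+-monoʳ-< (suc j′) (n<1+n t))))

  ∣closer-difference∣ : ∀ i {t} → i < a → t < b →
    ∣ closer (vertex i t) (vertex i (suc t)) - closer (vertex i (suc t)) (vertex i t) ∣ ≡ suc (t + t + a′ * b)
  ∣closer-difference∣ i {t} i<a t<b rewrite closer-inward i i<a t<b | closer-outward i i<a t<b =
    trans (cong (λ z → ∣ z - (b ∸ t) ∣) split)
          (trans (∣-∣-comm ((b ∸ t) + suc (t + t + a′ * b)) (b ∸ t)) (∣m-m+n∣≡n (b ∸ t) _))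
    where
    split : suc (t + (a ∸ 1) * b) ≡ (b ∸ t) + suc (t + t + a′ * b)
    split = begin
      suc (t + (b + a′ * b))               ≡⟨ cong (λ z → suc (t + (z + a′ * b))) (m∸n+n≡m (<⇒≤ t<b)) ⟨
      suc (t + ((b ∸ t) + t + a′ * b))     ≡⟨ solve-∀-split t (b ∸ t) (a′ * b) ⟩
      (b ∸ t) + suc (t + t + a′ * b)       ∎
      where
      open ≡-Reasoning
      solve-∀-split : ∀ t r k → suc (t + (r + t + k)) ≡ r + suc (t + t + k)
      solve-∀-split = solve-∀

  mostar-spider : mostar S ≡ a * a * b * b ∸ a * b * b
  mostar-spider = begin
      mostar S
    ≡⟨ mostar≡∑-legs ⟩
      ∑ a (λ i → ∑ b (λ t → ∣ closer (vertex i t) (vertex i (suc t)) - closer (vertex i (suc t)) (vertex i t) ∣))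
    ≡⟨ ∑-cong a (λ i i<a → ∑-cong b λ t t<b → ∣closer-difference∣ i i<a t<b) ⟩
      ∑ a (λ _ → ∑ b (λ t → suc (t + t + a′ * b)))
    ≡⟨ trans (∑-const a _) (cong (a *_) (∑-odd b (a′ * b))) ⟩
      a * (b * (a′ * b) + b * b)
    ≡⟨ m+n∸m≡n (a * b * b) _ ⟨
      a * b * b + a * (b * (a′ * b) + b * b) ∸ a * b * b
    ≡⟨ cong (_∸ a * b * b) (solve-∀-mostar a′ b) ⟨
      a * a * b * b ∸ a * b * b
    ∎
    where
    open ≡-Reasoning
    solve-∀-mostar : ∀ a′ b → (2 + a′) * (2 + a′) * b * b ≡
                              (2 + a′) * b * b + (2 + a′) * (b * (a′ * b) + b * b)
    solve-∀-mostar = solve-∀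

mainTheorem10 : ∀ (a b : ℕ) → 2 ≤ a → 1 ≤ b →
    (irr (spider a b) ≡ a * (a ∸ 1)) × (mostar (spider a b) ≡ a * a * b * b ∸ a * b * b)
mainTheorem10 (suc (suc a′)) (suc c) (s≤s (s≤s z≤n)) (s≤s z≤n) = Spider.irr-spider a′ c , Spider.mostar-spider a′ c
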